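{- Let $g:\mathbb{N}^n\to\{0,1\}^n$ be a monotone coordinate independent function and $h:\{0,1\}^n\to\mathbb{R}_+$ a monotone submodular function. Then the composition $f=h\circ g:\mathbb{N}^n\to\mathbb{R}_+$ is a monotone submodular function over the integer lattice, i.e. $f(x)\le f(y)$ whenever $x\le y$, and $f(x)+f(y)\ge f(x\vee y)+f(x\wedge y)$ for all $x,y\in\mathbb{N}^n$.
   Context: Vectors in $\{0,1\}^n$ are identified with subsets of $[n]$; order, $\vee$ (coordinate-wise maximum) and $\wedge$ (coordinate-wise minimum) are coordinate-wise. $g$ is monotone if $x\le y$ implies $g(x)\le g(y)$; $g$ is coordinate independent if $g(x\vee y)\le g(x)\vee g(y)$ for all $x,y\in\mathbb{N}^n$. $h$ is monotone and submodular as a set function: $h(S)\le h(T)$ for $S\subseteq T$ and $h(S)+h(T)\ge h(S\cup T)+h(S\cap T)$. -}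

module Defs where

open import Level using (Level) renaming (suc to lsuc; _⊔_ to _⊔ˡ_)
open import Data.Nat using (ℕ; _⊔_; _⊓_) renaming (_≤_ to _≤ℕ_)
open import Data.Bool using (Bool; _∨_; _∧_) renaming (_≤_ to _≤𝔹_)
open import Data.Fin using (Fin)
open import Relation.Binary.PropositionalEquality using (_≡_)
open import Relation.Binary.Structures using (IsPreorder)
open import Relation.Binary.Definitions using (Monotonic₂)
open import Algebra.Structures using (IsCommutativeMonoid)

ℕ^ : ℕ → Set
ℕ^ n = Fin n → ℕ

-- {0,1}^n identified with subsets of [n] : functions Fin n → Bool
𝔹^ : ℕ → Set
𝔹^ n = Fin n → Bool

_≤ᴺ_ : ∀ {n} → ℕ^ n → ℕ^ n → Set
x ≤ᴺ y = ∀ i → x i ≤ℕ y i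

_∨ᴺ_ : ∀ {n} → ℕ^ n → ℕ^ n → ℕ^ n
(x ∨ᴺ y) i = x i ⊔ y i

_∧ᴺ_ : ∀ {n} → ℕ^ n → ℕ^ n → ℕ^ n
(x ∧ᴺ y) i = x i ⊓ y i

_≤ᴮ_ : ∀ {n} → 𝔹^ n → 𝔹^ n → Set
S ≤ᴮ T = ∀ i → S i ≤𝔹 T i

_∪_ : ∀ {n} → 𝔹^ n → 𝔹^ n → 𝔹^ n
(S ∪ T) i = S i ∨ T i

_∩_ : ∀ {n} → 𝔹^ n → 𝔹^ n → 𝔹^ n
(S ∩ T) i = S i ∧ T i

MonotoneG : ∀ {n} → (ℕ^ n → 𝔹^ n) → Set
MonotoneG g = ∀ x y → x ≤ᴺ y → g x ≤ᴮ g y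

CoordIndependent : ∀ {n} → (ℕ^ n → 𝔹^ n) → Set
CoordIndependent g = ∀ x y → g (x ∨ᴺ y) ≤ᴮ (g x ∪ g y)

-- Codomain for the values (ℝ₊ in the paper; no reals in agda-stdlib):
-- an ordered commutative monoid (preorder, commutative monoid, + monotone).
record OrderedCommMonoid (c ℓ : Level) : Set (lsuc (c ⊔ˡ ℓ)) where
  field
    Carrier : Set c
    _≤_ : Carrier → Carrier → Set ℓ
    _+_ : Carrier → Carrier → Carrier
    0# : Carrier
    isPreorder : IsPreorder _≡_ _≤_
    isCommutativeMonoid : IsCommutativeMonoid _≡_ _+_ 0#
    +-mono-≤ : Monotonic₂ _≤_ _≤_ _≤_ _+_

module _ {c ℓ : Level} (M : OrderedCommMonoid c ℓ) where
  open OrderedCommMonoid M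

  MonotoneSetFn : ∀ {n} → (𝔹^ n → Carrier) → Set ℓ
  MonotoneSetFn h = ∀ S T → S ≤ᴮ T → h S ≤ h T

  SubmodularSetFn : ∀ {n} → (𝔹^ n → Carrier) → Set ℓ
  SubmodularSetFn h = ∀ S T → (h (S ∪ T) + h (S ∩ T)) ≤ (h S + h T)

  MonotoneLattice : ∀ {n} → (ℕ^ n → Carrier) → Set ℓ
  MonotoneLattice f = ∀ x y → x ≤ᴺ y → f x ≤ f y

  SubmodularLattice : ∀ {n} → (ℕ^ n → Carrier) → Set ℓ
  SubmodularLattice f = ∀ x y → (f (x ∨ᴺ y) + f (x ∧ᴺ y)) ≤ (f x + f y)

-- The meet is the one place where coordinate independence is not available:
-- monotonicity of g alone gives g (x ∧ y) ≤ g x ∩ g y, while coordinate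
-- independence gives g (x ∨ y) ≤ g x ∪ g y. Monotonicity of h lifts both
-- bounds, and submodularity of h at (g x, g y) closes the chain.
module Submission where

open import Defs
open import Level using (Level)
open import Data.Nat using (ℕ)
open import Data.Nat.Properties using (m⊓n≤m; m⊓n≤n)
open import Data.Bool using (true; false; _∧_) renaming (_≤_ to _≤𝔹_)
open import Data.Bool.Base using (b≤b; f≤t)
open import Data.Product using (_×_; _,_)
open import Function using (_∘_)
open import Relation.Binary.Structures using (IsPreorder)

∧-greatest : ∀ {a b c} → a ≤𝔹 b → a ≤𝔹 c → a ≤𝔹 (b ∧ c)
∧-greatest {false} {false}         _   _   = b≤b
∧-greatest {false} {true}  {false} _   _   = b≤b
∧-greatest {false} {true}  {true}  _   _   = f≤t
∧-greatest {true}          b≤b     b≤b     = b≤b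

∩-greatest : ∀ {n} {R S T : 𝔹^ n} → R ≤ᴮ S → R ≤ᴮ T → R ≤ᴮ (S ∩ T)
∩-greatest R≤S R≤T i = ∧-greatest (R≤S i) (R≤T i)

∧ᴺ-lowerˡ : ∀ {n} (x y : ℕ^ n) → (x ∧ᴺ y) ≤ᴺ x
∧ᴺ-lowerˡ x y i = m⊓n≤m (x i) (y i)

∧ᴺ-lowerʳ : ∀ {n} (x y : ℕ^ n) → (x ∧ᴺ y) ≤ᴺ y
∧ᴺ-lowerʳ x y i = m⊓n≤n (x i) (y i)

monotone-∧ᴺ-≤ᴮ-∩ : ∀ {n} {g : ℕ^ n → 𝔹^ n} → MonotoneG g →
                   ∀ x y → g (x ∧ᴺ y) ≤ᴮ (g x ∩ g y)
monotone-∧ᴺ-≤ᴮ-∩ {g = g} g-mono x y =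
  ∩-greatest (g-mono (x ∧ᴺ y) x (∧ᴺ-lowerˡ x y))
             (g-mono (x ∧ᴺ y) y (∧ᴺ-lowerʳ x y))

module _ {c ℓ : Level} (M : OrderedCommMonoid c ℓ) where
  open OrderedCommMonoid M
  open IsPreorder isPreorder using (trans)

  ∘-monotoneLattice : ∀ {n} {g : ℕ^ n → 𝔹^ n} {h : 𝔹^ n → Carrier} →
                      MonotoneG g → MonotoneSetFn M h →
                      MonotoneLattice M (h ∘ g)
  ∘-monotoneLattice {g = g} g-mono h-mono x y x≤y =
    h-mono (g x) (g y) (g-mono x y x≤y)

  ∘-submodularLattice : ∀ {n} {g : ℕ^ n → 𝔹^ n} {h : 𝔹^ n → Carrier} →
                        MonotoneG g → CoordIndependent g →
                        MonotoneSetFn M h → SubmodularSetFn M h →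
                        SubmodularLattice M (h ∘ g)
  ∘-submodularLattice {g = g} g-mono g-indep h-mono h-sub x y =
    trans (+-mono-≤ (h-mono _ _ (g-indep x y))
                    (h-mono _ _ (monotone-∧ᴺ-≤ᴮ-∩ g-mono x y)))
          (h-sub (g x) (g y))

lemma2 : ∀ {c ℓ : Level} (M : OrderedCommMonoid c ℓ) (n : ℕ)
           (g : ℕ^ n → 𝔹^ n) (h : 𝔹^ n → OrderedCommMonoid.Carrier M) →
           MonotoneG g → CoordIndependent g →
           MonotoneSetFn M h → SubmodularSetFn M h →
           MonotoneLattice M (h ∘ g) × SubmodularLattice M (h ∘ g)
lemma2 M n g h g-mono g-indep h-mono h-sub =
  ∘-monotoneLattice M g-mono h-mono ,
  ∘-submodularLattice M g-mono g-indep h-mono h-sub
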